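{- (i) The set $\mathrm{ETA}_\omega$ is closed under composition: if $Q_1,Q_2\in\mathrm{ETA}_\omega$ then $Q_1\circ Q_2\in\mathrm{ETA}_\omega$; moreover $Q_1\circ Q_2\in\mathrm{ETA}_\infty$ whenever one of $Q_1,Q_2$ belongs to $\mathrm{ETA}_\infty$. (ii) If $Q\in\mathrm{ETA}_\infty$ then $Q\,\mathtt I\in\mathrm{ETA}_\infty$.
   Context: $\mathtt I=\lambda x.x$; composition is $Q_1\circ Q_2=\mathtt BQ_1Q_2$ with $\mathtt B=\lambda fgx.f(gx)$. Böhm trees $BT(M)$ defined coinductively (root $\lambda x_1\dots x_n.y$ with subtrees $BT(M_i)$ if $M$ head-reduces to $\lambda x_1\dots x_n.yM_1\cdots M_k$, else $\bot$). $\le^\eta_\omega$ is the greatest relation on Böhm-like trees such that $U\le^\eta_\omega V$ implies $U=V=\bot$, or $U=\lambda\vec x.yU_1\cdots U_k$, $V=\lambda\vec xz_1\dots z_m.yV_1\cdots V_kV'_1\cdots V'_m$ with $\vec z$ not free in $yU_1\cdots U_kV_1\cdots V_k$, $U_j\le^\eta_\omega V_j$ and $z_i\le^\eta_\omega V'_i$. $\mathrm{ETA}_\omega$ is the set of $\lambda$-terms $Q$ with $BT(\mathtt I)\le^\eta_\omega BT(Q)$; $\mathrm{ETA}_\infty$ is the set of $Q\in\mathrm{ETA}_\omega$ whose Böhm tree is infinite. -}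

module Defs where

open import Data.Nat using (ℕ; zero; suc; _+_)
open import Data.Nat.Properties using (+-assoc; +-comm)
open import Data.Fin using (Fin; zero; suc; _↑ˡ_; _↑ʳ_; splitAt; opposite; cast)
open import Data.Sum using (_⊎_; inj₁; inj₂; [_,_])
open import Data.Product using (Σ; ∃; _×_; _,_)
open import Data.List using (List; []; _∷_; _++_; map; allFin)
open import Data.List.Relation.Unary.All using (All)
open import Data.List.Relation.Binary.Pointwise using (Pointwise)
open import Data.Empty using (⊥)
open import Relation.Nullary using (¬_)
open import Relation.Binary.PropositionalEquality using (_≡_; sym; trans; cong)
open import Relation.Binary.Construct.Closure.ReflexiveTransitive using (Star)

data Tm (n : ℕ) : Set where
  var : Fin n → Tm n
  app : Tm n → Tm n → Tm n
  lam : Tm (suc n) → Tm n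

ext : ∀ {m n} → (Fin m → Fin n) → Fin (suc m) → Fin (suc n)
ext ρ zero    = zero
ext ρ (suc i) = suc (ρ i)

ren : ∀ {m n} → (Fin m → Fin n) → Tm m → Tm n
ren ρ (var i)   = var (ρ i)
ren ρ (app M N) = app (ren ρ M) (ren ρ N)
ren ρ (lam M)   = lam (ren (ext ρ) M)

exts : ∀ {m n} → (Fin m → Tm n) → Fin (suc m) → Tm (suc n)
exts σ zero    = var zero
exts σ (suc i) = ren suc (σ i)

sub : ∀ {m n} → (Fin m → Tm n) → Tm m → Tm n
sub σ (var i)   = σ i
sub σ (app M N) = app (sub σ M) (sub σ N)
sub σ (lam M)   = lam (sub (exts σ) M)

sub1 : ∀ {n} → Tm n → Fin (suc n) → Tm n
sub1 N zero    = N
sub1 N (suc i) = var i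

_[_] : ∀ {n} → Tm (suc n) → Tm n → Tm n
M [ N ] = sub (sub1 N) M

data NotLam {n} : Tm n → Set where
  nl-var : ∀ {i} → NotLam (var i)
  nl-app : ∀ {M N} → NotLam (app M N)

data _→h_ {n} : Tm n → Tm n → Set where
  h-β   : ∀ {M N} → app (lam M) N →h (M [ N ])
  h-app : ∀ {M M' N} → NotLam M → M →h M' → app M N →h app M' N
  h-lam : ∀ {M M'} → M →h M' → lam M →h lam M'

_→h*_ : ∀ {n} → Tm n → Tm n → Set
_→h*_ = Star _→h_

-- λx₁…x_k.  (x_k is de Bruijn index 0)
lams : ∀ {n} (k : ℕ) → Tm (k + n) → Tm n
lams zero    M = M
lams (suc k) M = lams k (lam M)

apps : ∀ {n} → Tm n → List (Tm n) → Tm n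
apps M []       = M
apps M (N ∷ Ns) = apps (app M N) Ns

hnf : ∀ {n} (k : ℕ) → Fin (k + n) → List (Tm (k + n)) → Tm n
hnf k y Ms = lams k (apps (var y) Ms)

HasHnf : ∀ {n} → Tm n → Set
HasHnf {n} M = Σ ℕ λ k → Σ (Fin (k + n)) λ y → Σ (List (Tm (k + n))) λ Ms → M →h* hnf k y Ms

-- BT(M) = λx₁…x_k. y BT(M₁) … BT(M_l)  if  M →h* λx₁…x_k. y M₁ … M_l,  else ⊥.

-- BT(M) is a finite tree (inductively); "infinite" = not finite
data FiniteBT {n} (M : Tm n) : Set where
  fin-bot  : ¬ HasHnf M → FiniteBT M
  fin-node : ∀ {k y Ms} → M →h* hnf k y Ms → All FiniteBT Ms → FiniteBT M

-- De Bruijn rendering: a relation indexed by a renaming ρ : Fin a → Fin b;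
-- "BT(M) ≤ BT(N) under ρ" means that a free variable i of BT(M) is the same
-- variable as ρ i in BT(N).

liftₖ : ∀ {a b} (k : ℕ) → (Fin a → Fin b) → Fin (k + a) → Fin (k + b)
liftₖ {a} {b} k ρ i = [ (λ x → x ↑ˡ b) , (λ j → k ↑ʳ ρ j) ] (splitAt k i)

eqη : ∀ m k b → m + (k + b) ≡ (k + m) + b
eqη m k b = trans (sym (+-assoc m k b)) (cong (_+ b) (+-comm m k))

-- renaming of the scope of U's root (binders x⃗, then free vars) into the scope
-- of V's root λx⃗ z⃗ (z⃗ innermost, then free vars).  Its image avoids z⃗.
under : ∀ {a b} (k m : ℕ) → (Fin a → Fin b) → Fin (k + a) → Fin ((k + m) + b)
under {a} {b} k m ρ i = cast (eqη m k b) (m ↑ʳ liftₖ k ρ i)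

-- the variable z_{i+1} (i = 0 … m-1) of V's root λx⃗ z₁…z_m
zvar : ∀ {b} (k m : ℕ) → Fin m → Fin ((k + m) + b)
zvar {b} k m i = cast (eqη m k b) (opposite i ↑ˡ (k + b))

Rel : Set₁
Rel = ∀ {a b} → (Fin a → Fin b) → Tm a → Tm b → Set

-- one unfolding of the defining clause of ≤^η_ω :
--   BT(M) = BT(N) = ⊥,  or
--   BT(M) = λx⃗.y BT(M₁)…BT(M_l),  BT(N) = λx⃗ z₁…z_m. y BT(N₁)…BT(N_l) BT(N'₁)…BT(N'_m)
--   with BT(M_j) R BT(N_j) and z_i R BT(N'_i)
Step : Rel → Rel
Step R {a} {b} ρ M N =
  (¬ HasHnf M × ¬ HasHnf N)
  ⊎ (Σ ℕ λ k → Σ ℕ λ m → Σ (Fin (k + a)) λ y →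
     Σ (List (Tm (k + a))) λ Ms →
     Σ (List (Tm ((k + m) + b))) λ Ns →
     Σ (List (Tm ((k + m) + b))) λ N's →
       M →h* hnf k y Ms
     × N →h* hnf (k + m) (under k m ρ y) (Ns ++ N's)
     × Pointwise (R (under k m ρ)) Ms Ns
     × Pointwise (λ i N' → R (λ x → x) (var (zvar k m i)) N') (allFin m) N's)

PostFixed : Rel → Set
PostFixed R = ∀ {a b} {ρ : Fin a → Fin b} {M N} → R ρ M N → Step R ρ M N

-- BT(M) ≤^η_ω BT(N): the greatest such relation, i.e. the union of all post-fixed points
_≤ηω_ : ∀ {n} → Tm n → Tm n → Set₁
M ≤ηω N = Σ Rel λ R → PostFixed R × R (λ x → x) M N

𝙸 : ∀ {n} → Tm n
𝙸 = lam (var zero)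

𝙱 : ∀ {n} → Tm n
𝙱 = lam (lam (lam (app (var (suc (suc zero))) (app (var (suc zero)) (var zero)))))

_∘ₜ_ : ∀ {n} → Tm n → Tm n → Tm n
Q₁ ∘ₜ Q₂ = app (app 𝙱 Q₁) Q₂

ETAω : ∀ {n} → Tm n → Set₁
ETAω Q = 𝙸 ≤ηω Q

ETA∞ : ∀ {n} → Tm n → Set₁
ETA∞ Q = ETAω Q × ¬ FiniteBT Q

module Submission where

-- Fix a post-fixed point R of the clause defining ≤^η_ω.  From R on variables we
-- generate inductively "BT(N) is an η-expansion of x", closed under reflexivity,
-- backward head reduction, one layer of η-expansion and substitution (A expands α
-- and σ α expands β ⇒ A[σ] expands β).  The substitution lemma for spines shows
-- that every expansion still unfolds by one layer, so expansions form a
-- post-fixed point and Q ↠ λx.N with N expanding x puts Q in ETA_ω.  Both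
-- Q₁ ∘ Q₂ ↠ λx.Q₁(Q₂ x) and Q 𝙸 ↠ N[𝙸] are substitution instances of this kind.
-- For ETA_∞ we use depth: finite Böhm trees have bounded depth, infinite ones are
-- (up to double negation) arbitrarily deep, and rerunning the substitution lemma
-- with depth-tracing flags shows that A[σ] is as deep as A and as σ α.

open import Defs
open import Data.Bool using (Bool; true; false; _∨_; T)
open import Data.Bool.Properties using (∨-assoc; ∨-identityʳ; ∨-commutativeMonoid)
open import Algebra.Bundles using (CommutativeMonoid)
open import Algebra.Properties.CommutativeSemigroup (CommutativeMonoid.commutativeSemigroup ∨-commutativeMonoid) using (interchange)
open import Data.Empty using (⊥; ⊥-elim)
open import Data.Unit using (tt)
open import Data.Fin using (Fin; zero; suc; toℕ; cast; _↑ʳ_; opposite)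
open import Data.Fin.Properties using (toℕ-injective; toℕ-cast; toℕ-↑ʳ; toℕ-↑ˡ; opposite-prop; cast-is-id; cast-involutive)
open import Data.List using (List; []; _∷_; _++_; map; allFin; tabulate; downFrom; applyDownFrom)
open import Data.List.Properties using (map-∘; map-++; map-id; map-cong; map-injective; ++-assoc; ++-identityʳ; map-tabulate; tabulate-cong; map-downFrom; downFrom-∷ʳ)
open import Data.List.Relation.Unary.All as All using (All; []; _∷_)
open import Data.List.Relation.Unary.All.Properties using (¬Any⇒All¬; All¬⇒¬Any) renaming (map⁺ to All-map⁺)
open import Data.List.Relation.Unary.Any as Any using (Any; here; there)
open import Data.List.Relation.Unary.Any.Properties using () renaming (map⁺ to Any-map⁺)
open import Data.List.Relation.Binary.Pointwise as Pointwise using (Pointwise; []; _∷_)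
open import Data.Nat using (ℕ; zero; suc; _+_; _∸_; _≤′_; ≤′-refl; ≤′-step)
open import Data.Nat.Properties using (+-suc; +-identityʳ; m≤m+n; m≤n+m; ≤⇒≤′)
open import Data.Product using (Σ; _×_; _,_; proj₂)
open import Data.Sum using (_⊎_; inj₁; inj₂) renaming (map to ⊎-map)
open import Function using (_∘_; id)
open import Relation.Nullary using (¬_)
open import Relation.Binary.PropositionalEquality using (_≡_; refl; sym; trans; cong; cong₂; subst; subst₂; module ≡-Reasoning)
open import Relation.Binary.Construct.Closure.ReflexiveTransitive using (ε; _◅_; _◅◅_; gmap)

-- The one with content is sub-[]: substitution
-- commutes with β-contraction, which makes head reduction stable under σ.

ren-cong : ∀ {m n} {ρ ρ' : Fin m → Fin n} → (∀ i → ρ i ≡ ρ' i) → ∀ M → ren ρ M ≡ ren ρ' M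
ren-cong e (var i)   = cong var (e i)
ren-cong e (app M N) = cong₂ app (ren-cong e M) (ren-cong e N)
ren-cong e (lam M)   = cong lam (ren-cong (λ { zero → refl ; (suc i) → cong suc (e i) }) M)

sub-cong : ∀ {m n} {σ σ' : Fin m → Tm n} → (∀ i → σ i ≡ σ' i) → ∀ M → sub σ M ≡ sub σ' M
sub-cong e (var i)   = e i
sub-cong e (app M N) = cong₂ app (sub-cong e M) (sub-cong e N)
sub-cong e (lam M)   = cong lam (sub-cong (λ { zero → refl ; (suc i) → cong (ren suc) (e i) }) M)

ren-ren : ∀ {l m n} (ρ : Fin m → Fin n) (ρ' : Fin l → Fin m) M → ren ρ (ren ρ' M) ≡ ren (ρ ∘ ρ') M
ren-ren ρ ρ' (var i)   = refl
ren-ren ρ ρ' (app M N) = cong₂ app (ren-ren ρ ρ' M) (ren-ren ρ ρ' N)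
ren-ren ρ ρ' (lam M)   =
  cong lam (trans (ren-ren (ext ρ) (ext ρ') M) (ren-cong (λ { zero → refl ; (suc i) → refl }) M))

ren-id : ∀ {n} (M : Tm n) → ren id M ≡ M
ren-id (var i)   = refl
ren-id (app M N) = cong₂ app (ren-id M) (ren-id N)
ren-id (lam M)   = cong lam (trans (ren-cong (λ { zero → refl ; (suc i) → refl }) M) (ren-id M))

ren-inverse : ∀ {m n} {ρ : Fin m → Fin n} {ρ' : Fin n → Fin m} → (∀ i → ρ' (ρ i) ≡ i) →
  ∀ M → ren ρ' (ren ρ M) ≡ M
ren-inverse inv M = trans (ren-ren _ _ M) (trans (ren-cong inv M) (ren-id M))

ren-as-sub : ∀ {m n} (ρ : Fin m → Fin n) M → ren ρ M ≡ sub (var ∘ ρ) M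
ren-as-sub ρ (var i)   = refl
ren-as-sub ρ (app M N) = cong₂ app (ren-as-sub ρ M) (ren-as-sub ρ N)
ren-as-sub ρ (lam M)   =
  cong lam (trans (ren-as-sub (ext ρ) M) (sub-cong (λ { zero → refl ; (suc i) → refl }) M))

sub-ren : ∀ {l m n} (σ : Fin m → Tm n) (ρ : Fin l → Fin m) M → sub σ (ren ρ M) ≡ sub (σ ∘ ρ) M
sub-ren σ ρ (var i)   = refl
sub-ren σ ρ (app M N) = cong₂ app (sub-ren σ ρ M) (sub-ren σ ρ N)
sub-ren σ ρ (lam M)   =
  cong lam (trans (sub-ren (exts σ) (ext ρ) M) (sub-cong (λ { zero → refl ; (suc i) → refl }) M))

ren-sub : ∀ {l m n} (ρ : Fin m → Fin n) (σ : Fin l → Tm m) M → ren ρ (sub σ M) ≡ sub (ren ρ ∘ σ) M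
ren-sub ρ σ (var i)   = refl
ren-sub ρ σ (app M N) = cong₂ app (ren-sub ρ σ M) (ren-sub ρ σ N)
ren-sub ρ σ (lam M)   = cong lam (trans (ren-sub (ext ρ) (exts σ) M) (sub-cong exts-comm M))
  where
  exts-comm : ∀ i → ren (ext ρ) (exts σ i) ≡ exts (ren ρ ∘ σ) i
  exts-comm zero    = refl
  exts-comm (suc i) = trans (ren-ren (ext ρ) suc (σ i)) (sym (ren-ren suc ρ (σ i)))

sub-sub : ∀ {l m n} (σ : Fin m → Tm n) (τ : Fin l → Tm m) M → sub σ (sub τ M) ≡ sub (sub σ ∘ τ) M
sub-sub σ τ (var i)   = refl
sub-sub σ τ (app M N) = cong₂ app (sub-sub σ τ M) (sub-sub σ τ N)
sub-sub σ τ (lam M)   = cong lam (trans (sub-sub (exts σ) (exts τ) M) (sub-cong exts-comm M))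
  where
  exts-comm : ∀ i → sub (exts σ) (exts τ i) ≡ exts (sub σ ∘ τ) i
  exts-comm zero    = refl
  exts-comm (suc i) = trans (sub-ren (exts σ) suc (τ i)) (sym (ren-sub suc σ (τ i)))

sub-var : ∀ {n} (M : Tm n) → sub var M ≡ M
sub-var M = trans (sym (ren-as-sub id M)) (ren-id M)

sub-[] : ∀ {m n} (σ : Fin m → Tm n) (M : Tm (suc m)) N → sub σ (M [ N ]) ≡ sub (exts σ) M [ sub σ N ]
sub-[] σ M N = trans (sub-sub σ (sub1 N) M) (sym (trans (sub-sub (sub1 (sub σ N)) (exts σ) M) (sub-cong agree M)))
  where
  agree : ∀ i → sub (sub1 (sub σ N)) (exts σ i) ≡ sub σ (sub1 N i)
  agree zero    = refl
  agree (suc i) = trans (sub-ren (sub1 (sub σ N)) suc (σ i)) (sub-var (σ i))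

sub-apps : ∀ {m n} (σ : Fin m → Tm n) M Ns → sub σ (apps M Ns) ≡ apps (sub σ M) (map (sub σ) Ns)
sub-apps σ M []       = refl
sub-apps σ M (N ∷ Ns) = sub-apps σ (app M N) Ns

ren-apps : ∀ {m n} (ρ : Fin m → Fin n) M Ns → ren ρ (apps M Ns) ≡ apps (ren ρ M) (map (ren ρ) Ns)
ren-apps ρ M []       = refl
ren-apps ρ M (N ∷ Ns) = ren-apps ρ (app M N) Ns

apps-++ : ∀ {n} (M : Tm n) Ns Ns' → apps M (Ns ++ Ns') ≡ apps (apps M Ns) Ns'
apps-++ M []       Ns' = refl
apps-++ M (N ∷ Ns) Ns' = apps-++ (app M N) Ns Ns'

sub-NotLam : ∀ {m n} (σ : Fin m → Tm n) {M M'} → M →h M' → NotLam M → NotLam (sub σ M)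
sub-NotLam σ () nl-var
sub-NotLam σ _  nl-app = nl-app

sub-→h : ∀ {m n} (σ : Fin m → Tm n) {M M'} → M →h M' → sub σ M →h sub σ M'
sub-→h σ (h-β {M} {N}) = subst (sub σ (app (lam M) N) →h_) (sym (sub-[] σ M N)) h-β
sub-→h σ (h-app nl r)  = h-app (sub-NotLam σ r nl) (sub-→h σ r)
sub-→h σ (h-lam r)     = h-lam (sub-→h (exts σ) r)

sub-→h* : ∀ {m n} (σ : Fin m → Tm n) {M M'} → M →h* M' → sub σ M →h* sub σ M'
sub-→h* σ = gmap (sub σ) (sub-→h σ)

ren-→h* : ∀ {m n} (ρ : Fin m → Fin n) {M M'} → M →h* M' → ren ρ M →h* ren ρ M'
ren-→h* ρ {M} {M'} rs = subst₂ _→h*_ (sym (ren-as-sub ρ M)) (sym (ren-as-sub ρ M')) (sub-→h* (var ∘ ρ) rs)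

lam-→h* : ∀ {n} {M M' : Tm (suc n)} → M →h* M' → lam M →h* lam M'
lam-→h* = gmap lam h-lam

lam-→h*-inv : ∀ {n} {X : Tm (suc n)} {Y} → lam X →h* Y → Σ (Tm (suc n)) λ X' → (Y ≡ lam X') × (X →h* X')
lam-→h*-inv ε = _ , refl , ε
lam-→h*-inv (h-lam r ◅ rs) with lam-→h*-inv rs
... | X' , e , rs' = X' , e , (r ◅ rs')

lam-→h*-body : ∀ {n} {X X' : Tm (suc n)} → lam X →h* lam X' → X →h* X'
lam-→h*-body rs with lam-→h*-inv rs
... | _ , refl , rs' = rs'

lam-↛NotLam : ∀ {n} {X : Tm (suc n)} {Y} → lam X →h* Y → ¬ NotLam Y
lam-↛NotLam rs nl with lam-→h*-inv rs
lam-↛NotLam rs () | _ , refl , _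

app-→h* : ∀ {n} {M M' : Tm n} N → M →h* M' → NotLam M' → app M N →h* app M' N
app-→h* N ε                  nl = ε
app-→h* N (h-β ◅ rs)         nl = h-app nl-app h-β ◅ app-→h* N rs nl
app-→h* N (h-app nl' r ◅ rs) nl = h-app nl-app (h-app nl' r) ◅ app-→h* N rs nl
app-→h* N (h-lam r ◅ rs)     nl = ⊥-elim (lam-↛NotLam (h-lam r ◅ rs) nl)

apps-→h : ∀ {n} {M M' : Tm n} Ns → M →h M' → NotLam M → apps M Ns →h apps M' Ns
apps-→h []       r nl = r
apps-→h (N ∷ Ns) r nl = apps-→h Ns (h-app nl r) nl-app

app-→h*-β : ∀ {n} {M : Tm n} {M₁} N → M →h* lam M₁ → app M N →h* (M₁ [ N ])
app-→h*-β N ε                 = h-β ◅ ε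
app-→h*-β N (h-β ◅ rs)        = h-app nl-app h-β ◅ app-→h*-β N rs
app-→h*-β N (h-app nl r ◅ rs) = h-app nl-app (h-app nl r) ◅ app-→h*-β N rs
app-→h*-β N (h-lam r ◅ rs)    = h-β ◅ sub-→h* (sub1 N) (lam-→h*-body (h-lam r ◅ rs))

det : ∀ {n} {M A B : Tm n} → M →h A → M →h B → A ≡ B
det h-β          h-β           = refl
det h-β          (h-app () r)
det (h-app () r) h-β
det (h-app _ r)  (h-app _ r')  = cong (λ T → app T _) (det r r')
det (h-lam r)    (h-lam r')    = cong lam (det r r')

det* : ∀ {n} {M A B : Tm n} → M →h* A → M →h* B → (A →h* B) ⊎ (B →h* A)
det* ε        rs'        = inj₁ rs'
det* rs       ε          = inj₂ rs
det* (r ◅ rs) (r' ◅ rs') with det r r'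
... | refl = det* rs rs'

Normal : ∀ {n} → Tm n → Set
Normal M = ∀ {M'} → ¬ (M →h M')

normal-end : ∀ {n} {A B : Tm n} → A →h* B → Normal A → A ≡ B
normal-end ε        nf = refl
normal-end (r ◅ rs) nf = ⊥-elim (nf r)

det-normal : ∀ {n} {M A B : Tm n} → M →h* A → M →h* B → Normal A → B →h* A
det-normal rs rs' nf with det* rs rs'
... | inj₁ ab rewrite normal-end ab nf = ε
... | inj₂ ba = ba

det-normal₂ : ∀ {n} {M A B : Tm n} → M →h* A → M →h* B → Normal A → Normal B → A ≡ B
det-normal₂ rs rs' nfA nfB = sym (normal-end (det-normal rs rs' nfA) nfB)

data Neutral {n} : Tm n → Set where
  ne-var : ∀ {i} → Neutral (var i)
  ne-app : ∀ {M N} → Neutral M → Neutral (app M N)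

neutral-normal : ∀ {n} {M : Tm n} → Neutral M → Normal M
neutral-normal ne-var      ()
neutral-normal (ne-app ()) h-β
neutral-normal (ne-app ne) (h-app _ r) = neutral-normal ne r

apps-neutral : ∀ {n} {M : Tm n} Ns → Neutral M → Neutral (apps M Ns)
apps-neutral []       ne = ne
apps-neutral (N ∷ Ns) ne = apps-neutral Ns (ne-app ne)

lams-normal : ∀ {n} k {M : Tm (k + n)} → Normal M → Normal (lams k M)
lams-normal zero    nf = nf
lams-normal (suc k) nf = lams-normal k λ { (h-lam r) → nf r }

hnf-normal : ∀ {n} k (y : Fin (k + n)) Ms → Normal (hnf k y Ms)
hnf-normal k y Ms = lams-normal k (neutral-normal (apps-neutral Ms ne-var))

apps-var-NotLam : ∀ {n} (y : Fin n) Ns → NotLam (apps (var y) Ns)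
apps-var-NotLam y Ns with apps (var y) Ns | apps-neutral Ns (ne-var {i = y})
... | _ | ne-var   = nl-var
... | _ | ne-app _ = nl-app

∘-→h* : ∀ {n} (Q₁ Q₂ : Tm n) → (Q₁ ∘ₜ Q₂) →h* lam (app (ren suc Q₁) (app (ren suc Q₂) (var zero)))
∘-→h* {n} Q₁ Q₂ = h-app nl-app h-β ◅ subst (app (lam (lam X)) Q₂ →h_) (cong (λ T → lam (app T _)) drop-Q₂) h-β ◅ ε
  where
  X : Tm (suc (suc n))
  X = app (ren suc (ren suc Q₁)) (app (var (suc zero)) (var zero))
  drop-Q₂ : sub (exts (sub1 Q₂)) (ren suc (ren suc Q₁)) ≡ ren suc Q₁
  drop-Q₂ = trans (cong (sub (exts (sub1 Q₂))) (ren-ren (λ (i : Fin (suc n)) → suc i) (λ (i : Fin n) → suc i) Q₁))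
                  (trans (sub-ren (exts (sub1 Q₂)) (λ i → suc (suc i)) Q₁) (sym (ren-as-sub suc Q₁)))

weaken-app-→h* : ∀ {n} {Q : Tm n} {Q₁} → Q →h* lam Q₁ → ∀ (W : Tm (suc n)) →
  app (ren suc Q) W →h* sub (sub1 W ∘ ext suc) Q₁
weaken-app-→h* {Q₁ = Q₁} r W = subst (_ →h*_) (sub-ren (sub1 W) (ext suc) Q₁) (app-→h*-β W (ren-→h* suc r))

sub-𝙸-head : ∀ {a b} {y : Fin a} {P A₁ As} (σ : Fin a → Tm b) → σ y ≡ 𝙸 → P →h* apps (var y) (A₁ ∷ As) →
  sub σ P →h* apps (sub σ A₁) (map (sub σ) As)
sub-𝙸-head {y = y} {A₁ = A₁} {As} σ e r =
  subst (_ →h*_) (trans (sub-apps σ (var y) (A₁ ∷ As)) (cong (λ T → apps (app T (sub σ A₁)) (map (sub σ) As)) e)) (sub-→h* σ r)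
  ◅◅ (apps-→h (map (sub σ) As) h-β nl-app ◅ ε)

-- the (m+1)-th variable from the inside is the last free variable of λ.lams m X
-- and the first bound variable of lams (m+1) X
shiftIn : ∀ m b → Fin (m + suc b) → Fin (suc m + b)
shiftIn m b = cast (+-suc m b)

shiftOut : ∀ m b → Fin (suc m + b) → Fin (m + suc b)
shiftOut m b = cast (sym (+-suc m b))

shiftIn-shiftOut : ∀ m b i → shiftIn m b (shiftOut m b i) ≡ i
shiftIn-shiftOut m b = cast-involutive (+-suc m b) (sym (+-suc m b))

lam-lams : ∀ {b} m (X : Tm (m + suc b)) → lam (lams m X) ≡ lams (suc m) (ren (shiftIn m b) X)
lam-lams zero    X = cong lam (sym (trans (ren-cong (cast-is-id _) X) (ren-id X)))
lam-lams (suc m) X = trans (lam-lams m (lam X))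
  (cong (λ T → lams m (lam (lam T))) (ren-cong (λ { zero → refl ; (suc i) → refl }) X))

lams-lam : ∀ {b} m (X : Tm (suc m + b)) → lams (suc m) X ≡ lam (lams m (ren (shiftOut m b) X))
lams-lam {b} m X = sym (trans (lam-lams m (ren (shiftOut m b) X))
  (cong (lams (suc m)) (ren-inverse (shiftIn-shiftOut m b) X)))

-- the variables x₁ … x_m bound by lams m, as seen from its body (x_m has index 0)
binders : ∀ m {b} → List (Fin (m + b))
binders zero    = []
binders (suc m) = map suc (binders m) ++ (zero ∷ [])

toℕ-binders : ∀ m {b} → map toℕ (binders m {b}) ≡ downFrom m
toℕ-binders zero        = refl
toℕ-binders (suc m) {b} = begin
  map toℕ (map suc (binders m) ++ (zero ∷ []))  ≡⟨ map-++ toℕ (map suc (binders m)) (zero ∷ []) ⟩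
  map toℕ (map suc (binders m)) ++ (0 ∷ [])     ≡⟨ cong (_++ (0 ∷ [])) (sym (map-∘ (binders m))) ⟩
  map (suc ∘ toℕ) (binders m) ++ (0 ∷ [])       ≡⟨ cong (_++ (0 ∷ [])) (map-∘ (binders m)) ⟩
  map suc (map toℕ (binders m)) ++ (0 ∷ [])     ≡⟨ cong (λ l → map suc l ++ (0 ∷ [])) (toℕ-binders m) ⟩
  map suc (downFrom m) ++ (0 ∷ [])              ≡⟨ cong (_++ (0 ∷ [])) (map-downFrom suc m) ⟩
  applyDownFrom suc m ++ (0 ∷ [])               ≡⟨ downFrom-∷ʳ m ⟩
  downFrom (suc m)                              ∎
  where open ≡-Reasoning

toℕs-injective : ∀ {n} {xs ys : List (Fin n)} → map toℕ xs ≡ map toℕ ys → xs ≡ ys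
toℕs-injective = map-injective toℕ-injective

zvar-binders : ∀ k m {b} → map (zvar {b} k m) (allFin m) ≡ map (cast (eqη m k b)) (binders m {k + b})
zvar-binders k m {b} = toℕs-injective (begin
  map toℕ (map (zvar k m) (allFin m))          ≡⟨ sym (map-∘ (allFin m)) ⟩
  map (toℕ ∘ zvar k m) (tabulate id)           ≡⟨ map-tabulate id (toℕ ∘ zvar k m) ⟩
  tabulate (toℕ ∘ zvar k m)                    ≡⟨ tabulate-cong toℕ-zvar ⟩
  tabulate (λ i → m ∸ suc (toℕ i))             ≡⟨ tabulate-downFrom m ⟩
  downFrom m                                   ≡⟨ sym (toℕ-binders m) ⟩
  map toℕ (binders m)                          ≡⟨ map-cong (λ i → sym (toℕ-cast _ i)) (binders m) ⟩
  map (toℕ ∘ cast (eqη m k b)) (binders m)     ≡⟨ map-∘ (binders m) ⟩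
  map toℕ (map (cast (eqη m k b)) (binders m)) ∎)
  where
  open ≡-Reasoning
  toℕ-zvar : ∀ i → toℕ (zvar {b} k m i) ≡ m ∸ suc (toℕ i)
  toℕ-zvar i = trans (toℕ-cast _ _) (trans (toℕ-↑ˡ (opposite i) (k + b)) (opposite-prop i))
  tabulate-downFrom : ∀ m → tabulate {n = m} (λ i → m ∸ suc (toℕ i)) ≡ downFrom m
  tabulate-downFrom zero    = refl
  tabulate-downFrom (suc m) = cong (m ∷_) (tabulate-downFrom m)

shiftIn-↑ʳ : ∀ m {b} (i : Fin b) → shiftIn m b (m ↑ʳ suc i) ≡ suc m ↑ʳ i
shiftIn-↑ʳ m {b} i = toℕ-injective (begin
  toℕ (shiftIn m b (m ↑ʳ suc i)) ≡⟨ toℕ-cast _ (m ↑ʳ suc i) ⟩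
  toℕ (m ↑ʳ suc i)               ≡⟨ toℕ-↑ʳ m (suc i) ⟩
  m + suc (toℕ i)                ≡⟨ +-suc m (toℕ i) ⟩
  suc (m + toℕ i)                ≡⟨ cong suc (sym (toℕ-↑ʳ m i)) ⟩
  toℕ (suc m ↑ʳ i)               ∎)
  where open ≡-Reasoning

shiftIn-binders : ∀ m {b} → map (shiftIn m b) ((m ↑ʳ zero) ∷ binders m) ≡ binders (suc m)
shiftIn-binders m {b} = toℕs-injective (trans (cong₂ _∷_ new-binder old-binders) (sym (toℕ-binders (suc m))))
  where
  open ≡-Reasoning
  old-binders : map toℕ (map (shiftIn m b) (binders m)) ≡ downFrom m
  old-binders = begin
    map toℕ (map (shiftIn m b) (binders m)) ≡⟨ sym (map-∘ (binders m)) ⟩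
    map (toℕ ∘ shiftIn m b) (binders m)     ≡⟨ map-cong (toℕ-cast _) (binders m) ⟩
    map toℕ (binders m)                     ≡⟨ toℕ-binders m ⟩
    downFrom m                              ∎
  new-binder : toℕ (shiftIn m b (m ↑ʳ zero)) ≡ m
  new-binder = trans (toℕ-cast _ (m ↑ʳ zero)) (trans (toℕ-↑ʳ m zero) (+-identityʳ m))

shiftIn-layer : ∀ m {b} (αs : List (Fin b)) →
  map (shiftIn m b) (map (m ↑ʳ_) (map suc αs ++ (zero ∷ [])) ++ binders m) ≡ map (suc m ↑ʳ_) αs ++ binders (suc m)
shiftIn-layer m {b} αs = begin
  map sh (map (m ↑ʳ_) (map suc αs ++ (zero ∷ [])) ++ binders m)
    ≡⟨ cong (λ l → map sh (l ++ binders m)) (map-++ (m ↑ʳ_) (map suc αs) (zero ∷ [])) ⟩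
  map sh ((map (m ↑ʳ_) (map suc αs) ++ ((m ↑ʳ zero) ∷ [])) ++ binders m)
    ≡⟨ cong (map sh) (++-assoc (map (m ↑ʳ_) (map suc αs)) ((m ↑ʳ zero) ∷ []) (binders m)) ⟩
  map sh (map (m ↑ʳ_) (map suc αs) ++ ((m ↑ʳ zero) ∷ binders m))
    ≡⟨ map-++ sh (map (m ↑ʳ_) (map suc αs)) ((m ↑ʳ zero) ∷ binders m) ⟩
  map sh (map (m ↑ʳ_) (map suc αs)) ++ map sh ((m ↑ʳ zero) ∷ binders m)
    ≡⟨ cong₂ _++_ (free αs) (shiftIn-binders m) ⟩
  map (suc m ↑ʳ_) αs ++ binders (suc m) ∎
  where
  open ≡-Reasoning
  sh = shiftIn m b
  free : ∀ αs → map sh (map (m ↑ʳ_) (map suc αs)) ≡ map (suc m ↑ʳ_) αs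
  free []       = refl
  free (α ∷ αs) = cong₂ _∷_ (shiftIn-↑ʳ m α) (free αs)

leadingLams : ∀ {n} → Tm n → ℕ
leadingLams (lam M)   = suc (leadingLams M)
leadingLams (var _)   = 0
leadingLams (app _ _) = 0

leadingLams-lams : ∀ {n} k (X : Tm (k + n)) → leadingLams (lams k X) ≡ k + leadingLams X
leadingLams-lams zero    X = refl
leadingLams-lams (suc k) X = trans (leadingLams-lams k (lam X)) (+-suc k (leadingLams X))

leadingLams-hnf : ∀ {n} k (y : Fin (k + n)) Ms → leadingLams (hnf k y Ms) ≡ k
leadingLams-hnf k y Ms = trans (leadingLams-lams k (apps (var y) Ms)) (trans (cong (k +_) no-λ) (+-identityʳ k))
  where
  no-λ : leadingLams (apps (var y) Ms) ≡ 0
  no-λ with apps (var y) Ms | apps-var-NotLam y Ms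
  ... | _ | nl-var = refl
  ... | _ | nl-app = refl

lams-injective : ∀ {n} k {X X' : Tm (k + n)} → lams k X ≡ lams k X' → X ≡ X'
lams-injective zero    e = e
lams-injective (suc k) e with lams-injective k e
... | refl = refl

spineHead : ∀ {n} → Tm n → Tm n
spineHead (app M N) = spineHead M
spineHead M         = M

spineArgs : ∀ {n} → Tm n → List (Tm n)
spineArgs (app M N) = spineArgs M ++ (N ∷ [])
spineArgs _         = []

spineHead-apps : ∀ {n} (M : Tm n) Ns → spineHead (apps M Ns) ≡ spineHead M
spineHead-apps M []       = refl
spineHead-apps M (N ∷ Ns) = spineHead-apps (app M N) Ns

spineArgs-apps : ∀ {n} (M : Tm n) Ns → spineArgs (apps M Ns) ≡ spineArgs M ++ Ns
spineArgs-apps M []       = sym (++-identityʳ (spineArgs M))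
spineArgs-apps M (N ∷ Ns) = trans (spineArgs-apps (app M N) Ns) (++-assoc (spineArgs M) (N ∷ []) Ns)

apps-var-injective : ∀ {n} {y y' : Fin n} Ms Ms' → apps (var y) Ms ≡ apps (var y') Ms' → (y ≡ y') × (Ms ≡ Ms')
apps-var-injective {y = y} {y'} Ms Ms' e
  with trans (sym (spineHead-apps (var y) Ms)) (trans (cong spineHead e) (spineHead-apps (var y') Ms'))
... | refl = refl , trans (sym (spineArgs-apps (var y) Ms)) (trans (cong spineArgs e) (spineArgs-apps (var y') Ms'))

hnf-lams-injective : ∀ {n} k k' (y : Fin (k + n)) (y' : Fin (k' + n)) Ms Ms' → hnf k y Ms ≡ hnf k' y' Ms' → k ≡ k'
hnf-lams-injective k k' y y' Ms Ms' e =
  trans (sym (leadingLams-hnf k y Ms)) (trans (cong leadingLams e) (leadingLams-hnf k' y' Ms'))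

hnf-injective : ∀ {n} k (y y' : Fin (k + n)) Ms Ms' → hnf k y Ms ≡ hnf k y' Ms' → (y ≡ y') × (Ms ≡ Ms')
hnf-injective k y y' Ms Ms' e = apps-var-injective Ms Ms' (lams-injective k e)

-- Fix a relation K x A f, read "A is an expansion of the variable x",
-- carrying a flag f (used only to trace the depth of Böhm trees later on).
-- Spine x αs N f says that, one layer deep, N is an η-expansion of x αs: N reduces
-- to x A₁…A_l with each A_i K-related to α_i, or to λ.N₁ where N₁ is a spine of
-- x applied to αs and the new bound variable.
module Spines (K : ∀ {b} → Fin b → Tm b → Bool → Set) where

  infixr 5 _∷_

  data Args {b} : List (Fin b) → List (Tm b) → Bool → Set where
    []  : Args [] [] false
    _∷_ : ∀ {α A αs As f g} → K α A f → Args αs As g → Args (α ∷ αs) (A ∷ As) (f ∨ g)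

  data SubArgs {a b} (σ : Fin a → Tm b) : List (Fin a) → List (Fin b) → Bool → Set where
    []  : SubArgs σ [] [] false
    _∷_ : ∀ {α β αs βs f g} → K β (σ α) f → SubArgs σ αs βs g → SubArgs σ (α ∷ αs) (β ∷ βs) (f ∨ g)

  data Spine : ∀ {b} → Fin b → List (Fin b) → Tm b → Bool → Set where
    spine-app : ∀ {b} {x : Fin b} {αs N As f} → N →h* apps (var x) As → Args αs As f → Spine x αs N f
    spine-lam : ∀ {b} {x : Fin b} {αs N N₁ f} →
      N →h* lam N₁ → Spine (suc x) (map suc αs ++ (zero ∷ [])) N₁ f → Spine x αs N f

  spine-←h* : ∀ {b} {x : Fin b} {αs M N f} → M →h* N → Spine x αs N f → Spine x αs M f
  spine-←h* rs (spine-app r p) = spine-app (rs ◅◅ r) p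
  spine-←h* rs (spine-lam r s) = spine-lam (rs ◅◅ r) s

  Args-++ : ∀ {b} {αs βs : List (Fin b)} {As Bs f g} → Args αs As f → Args βs Bs g → Args (αs ++ βs) (As ++ Bs) (f ∨ g)
  Args-++ []                                  q = q
  Args-++ {g = g} (_∷_ {f = f₁} {g = f₂} k p) q = subst (Args _ _) (sym (∨-assoc f₁ f₂ g)) (k ∷ Args-++ p q)

  SubArgs-++ : ∀ {a b} {σ : Fin a → Tm b} {αs βs γs δs f g} →
    SubArgs σ αs βs f → SubArgs σ γs δs g → SubArgs σ (αs ++ γs) (βs ++ δs) (f ∨ g)
  SubArgs-++ []                                  q = q
  SubArgs-++ {g = g} (_∷_ {f = f₁} {g = f₂} k p) q = subst (SubArgs _ _ _) (sym (∨-assoc f₁ f₂ g)) (k ∷ SubArgs-++ p q)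

  module SpineSubstitution
    (K-sub : ∀ {a b} {α : Fin a} {A : Tm a} {σ : Fin a → Tm b} {β : Fin b} {f g} →
             K α A f → K β (σ α) g → K β (sub σ A) (f ∨ g))
    (K-var : ∀ {b} {x : Fin b} → K x (var x) false) where

    K-ren : ∀ {a b} (ρ : Fin a → Fin b) {α A f} → K α A f → K (ρ α) (ren ρ A) f
    K-ren ρ {α} {A} {f} k = subst₂ (K (ρ α)) (sym (ren-as-sub ρ A)) (∨-identityʳ f) (K-sub {σ = var ∘ ρ} k K-var)

    SubArgs-ren : ∀ {a b} (ρ : Fin a → Fin b) αs → SubArgs (var ∘ ρ) αs (map ρ αs) false
    SubArgs-ren ρ []       = []
    SubArgs-ren ρ (α ∷ αs) = K-var ∷ SubArgs-ren ρ αs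

    SubArgs-exts : ∀ {a b} {σ : Fin a → Tm b} {αs βs c} → SubArgs σ αs βs c →
      SubArgs (exts σ) (map suc αs ++ (zero ∷ [])) (map suc βs ++ (zero ∷ [])) c
    SubArgs-exts {c = c} p = subst (SubArgs _ _ _) (∨-identityʳ c) (SubArgs-++ (weaken p) (K-var ∷ []))
      where
      weaken : ∀ {αs βs c} → SubArgs _ αs βs c → SubArgs _ (map suc αs) (map suc βs) c
      weaken []      = []
      weaken (k ∷ p) = K-ren suc k ∷ weaken p

    Args-sub : ∀ {a b} {σ : Fin a → Tm b} {αs As βs f c} → Args αs As f → SubArgs σ αs βs c →
      Args βs (map (sub σ) As) (f ∨ c)
    Args-sub []                          []                                = []
    Args-sub (_∷_ {f = f₁} {g = f₂} k p) (_∷_ {f = c₁} {g = c₂} k' q) =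
      subst (Args _ _) (interchange f₁ c₁ f₂ c₂) (K-sub k k' ∷ Args-sub p q)

    spine-subVar : ∀ {a b} {y : Fin a} {αs P f} → Spine y αs P f → (σ : Fin a → Tm b) {x : Fin b} →
      σ y ≡ var x → ∀ {βs c} → SubArgs σ αs βs c → Spine x βs (sub σ P) (f ∨ c)
    spine-subVar {y = y} (spine-app {As = As} r p) σ e q =
      spine-app (subst (_ →h*_) (trans (sub-apps σ (var y) As) (cong (λ T → apps T (map (sub σ) As)) e)) (sub-→h* σ r))
                (Args-sub p q)
    spine-subVar (spine-lam r s) σ e q = spine-lam (sub-→h* σ r) (spine-subVar s (exts σ) (cong (ren suc) e) (SubArgs-exts q))

    spine-ren : ∀ {a b} {y : Fin a} {αs P f} → Spine y αs P f → (ρ : Fin a → Fin b) → Spine (ρ y) (map ρ αs) (ren ρ P) f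
    spine-ren {αs = αs} {P} {f} s ρ =
      subst₂ (Spine _ _) (sym (ren-as-sub ρ P)) (∨-identityʳ f) (spine-subVar s (var ∘ ρ) refl (SubArgs-ren ρ αs))

    -- applying a spine of x γs to one more argument expanding β gives a spine of x γs β;
    -- if the spine starts with a λ this is a β-step substituting the argument
    spine-app1 : ∀ {b} {x : Fin b} {γs S f β A g} → Spine x γs S f → K β A g → Spine x (γs ++ (β ∷ [])) (app S A) (f ∨ g)
    spine-app1 {x = x} {A = A} {g = g} (spine-app {As = Cs} {f = f} r p) k =
      spine-app (subst (_ →h*_) (sym (apps-++ (var x) Cs (A ∷ []))) (app-→h* A r (apps-var-NotLam x Cs)))
                (subst (Args _ _) (cong (f ∨_) (∨-identityʳ g)) (Args-++ p (k ∷ [])))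
    spine-app1 {γs = γs} {A = A} {g = g} (spine-lam {f = f} r s) k =
      spine-←h* (app-→h*-β A r)
        (subst (Spine _ _ _) (cong (f ∨_) (∨-identityʳ g)) (spine-subVar s (sub1 A) refl (SubArgs-++ (lowered γs) (k ∷ []))))
      where
      -- sub1 A sends the variables above the contracted binder back down
      lowered : ∀ γs → SubArgs (sub1 A) (map suc γs) γs false
      lowered []       = []
      lowered (γ ∷ γs) = K-var ∷ lowered γs

    spine-apps : ∀ {b} {x : Fin b} {γs S f βs As g} → Spine x γs S f → Args βs As g → Spine x (γs ++ βs) (apps S As) (f ∨ g)
    spine-apps {γs = γs} {f = f} s [] =
      subst₂ (λ l h → Spine _ l _ h) (sym (++-identityʳ γs)) (sym (∨-identityʳ f)) s
    spine-apps {γs = γs} {f = f} s (_∷_ {α = β} {αs = βs} {f = g₁} {g = g₂} k p) =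
      subst₂ (λ l h → Spine _ l _ h) (++-assoc γs (β ∷ []) βs) (∨-assoc f g₁ g₂) (spine-apps (spine-app1 s k) p)

    spine-sub : ∀ {a b} {y : Fin a} {αs P f} → Spine y αs P f → (σ : Fin a → Tm b) → ∀ {x : Fin b} {s} →
      Spine x [] (σ y) s → ∀ {βs c} → SubArgs σ αs βs c → Spine x βs (sub σ P) (s ∨ (f ∨ c))
    spine-sub {y = y} (spine-app {As = As} r p) σ S q =
      spine-←h* (subst (_ →h*_) (sub-apps σ (var y) As) (sub-→h* σ r)) (spine-apps S (Args-sub p q))
    spine-sub (spine-lam r s) σ S q = spine-lam (sub-→h* σ r) (spine-sub s (exts σ) (spine-ren S suc) (SubArgs-exts q))

-- The defining clause of ≤^η_ω at the roots we meet: a variable x = hnf 0 x []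
-- and the identity 𝙸 = hnf 1 zero [].

Pointwise-mapˡ : ∀ {A C T : Set} {S : C → T → Set} (f : A → C) {xs ys} →
  Pointwise (λ a t → S (f a) t) xs ys → Pointwise S (map f xs) ys
Pointwise-mapˡ f []      = []
Pointwise-mapˡ f (r ∷ p) = r ∷ Pointwise-mapˡ f p

Pointwise-unmapˡ : ∀ {A C T : Set} {S : C → T → Set} (f : A → C) {xs ys} →
  Pointwise S (map f xs) ys → Pointwise (λ a t → S (f a) t) xs ys
Pointwise-unmapˡ f {[]}     []      = []
Pointwise-unmapˡ f {x ∷ xs} (r ∷ p) = r ∷ Pointwise-unmapˡ f p

RelVar : Rel → ∀ {b} → Fin b → Tm b → Set
RelVar R x N = R id (var x) N

RootLayer : (S : ∀ {b} → Fin b → Tm b → Set) → ∀ {a b} → (Fin a → Fin b) → (k : ℕ) → Fin (k + a) → Tm b → Set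
RootLayer S {a} {b} ρ k y N = Σ ℕ λ m → Σ (List (Tm ((k + m) + b))) λ N's →
  (N →h* hnf (k + m) (under k m ρ y) N's) × Pointwise S (map (zvar k m) (allFin m)) N's

unfold-root : ∀ {R : Rel} {a b} {ρ : Fin a → Fin b} {k} {y : Fin (k + a)} {N} →
  Step R ρ (hnf k y []) N → RootLayer (RelVar R) ρ k y N
unfold-root {k = k} {y} (inj₁ (no-hnf , _)) = ⊥-elim (no-hnf (k , y , [] , ε))
unfold-root {k = k} {y} (inj₂ (k' , m , y' , Ms , Ns , N's , r₁ , r₂ , p₁ , p₂))
  with hnf-lams-injective k k' y y' [] Ms (normal-end r₁ (hnf-normal k y []))
... | refl with hnf-injective k y y' [] Ms (normal-end r₁ (hnf-normal k y []))
... | refl , refl with p₁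
... | [] = m , N's , r₂ , Pointwise-mapˡ (zvar k m) p₂

fold-root : ∀ {R : Rel} {a b} {ρ : Fin a → Fin b} {k} {y : Fin (k + a)} {N} →
  RootLayer (RelVar R) ρ k y N → Step R ρ (hnf k y []) N
fold-root {k = k} {y} (m , N's , r , p) = inj₂ (k , m , y , [] , [] , N's , ε , r , [] , Pointwise-unmapˡ (zvar k m) p)

Layer : (S : ∀ {b} → Fin b → Tm b → Set) → ∀ {b} → Fin b → List (Fin b) → Tm b → Set
Layer S {b} x αs N = Σ ℕ λ m → Σ (List (Tm (m + b))) λ As →
  (N →h* lams m (apps (var (m ↑ʳ x)) As)) × Pointwise S (map (m ↑ʳ_) αs ++ binders m) As

zvar₀-binders : ∀ m {b} → map (zvar {b} 0 m) (allFin m) ≡ binders m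
zvar₀-binders m = trans (zvar-binders 0 m) (trans (map-cong (cast-is-id _) (binders m)) (map-id (binders m)))

rootLayer→layer : ∀ {S : ∀ {b} → Fin b → Tm b → Set} {b} {x : Fin b} {N} → RootLayer S id 0 x N → Layer S x [] N
rootLayer→layer {S} {x = x} (m , N's , r , p) =
  m , N's , subst (λ h → _ →h* lams m (apps (var h) N's)) (cast-is-id _ (m ↑ʳ x)) r ,
  subst (λ l → Pointwise S l N's) (zvar₀-binders m) p

layer→rootLayer : ∀ {S : ∀ {b} → Fin b → Tm b → Set} {a b} {ρ : Fin a → Fin b} {x : Fin a} {N} →
  Layer S (ρ x) [] N → RootLayer S ρ 0 x N
layer→rootLayer {S} {ρ = ρ} {x} (m , As , r , p) =
  m , As , subst (λ h → _ →h* lams m (apps (var h) As)) (sym (cast-is-id _ (m ↑ʳ ρ x))) r ,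
  subst (λ l → Pointwise S l As) (sym (zvar₀-binders m)) p

Layer-map : ∀ {S S' : ∀ {b} → Fin b → Tm b → Set} → (∀ {b} {x : Fin b} {N} → S x N → S' x N) →
  ∀ {b} {x : Fin b} {αs N} → Layer S x αs N → Layer S' x αs N
Layer-map f (m , As , r , p) = m , As , r , Pointwise.map f p

RootLayer-map : ∀ {S S' : ∀ {b} → Fin b → Tm b → Set} → (∀ {b} {x : Fin b} {N} → S x N → S' x N) →
  ∀ {a b} {ρ : Fin a → Fin b} {k y N} → RootLayer S ρ k y N → RootLayer S' ρ k y N
RootLayer-map f (m , As , r , p) = m , As , r , Pointwise.map f p

-- The key fact (unfold) is that every expansion
-- unfolds by one layer, so expansions themselves form a post-fixed point.
module Expansions (R : Rel) (R-post : PostFixed R) where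

  data Expansion : ∀ {b} → Fin b → Tm b → Set where
    exp-base  : ∀ {b} {x : Fin b} {N} → RelVar R x N → Expansion x N
    exp-var   : ∀ {b} {x : Fin b} → Expansion x (var x)
    exp-sub   : ∀ {a b} {α : Fin a} {A : Tm a} {σ : Fin a → Tm b} {β : Fin b} →
                Expansion α A → Expansion β (σ α) → Expansion β (sub σ A)
    exp-←h*   : ∀ {b} {x : Fin b} {M N} → M →h* N → Expansion x N → Expansion x M
    exp-layer : ∀ {b} {x : Fin b} {N} → Layer Expansion x [] N → Expansion x N

  Expansion-ren : ∀ {a b} (ρ : Fin a → Fin b) {x N} → Expansion x N → Expansion (ρ x) (ren ρ N)
  Expansion-ren ρ {x} {N} d = subst (Expansion (ρ x)) (sym (ren-as-sub ρ N)) (exp-sub {σ = var ∘ ρ} d exp-var)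

  Pointwise-ren : ∀ {a b} (ρ : Fin a → Fin b) {xs As} → Pointwise Expansion xs As →
    Pointwise Expansion (map ρ xs) (map (ren ρ) As)
  Pointwise-ren ρ p = Pointwise.map⁺ ρ (ren ρ) (Pointwise.map (Expansion-ren ρ) p)

  -- spines whose arguments are expansions (flags are irrelevant here)
  open Spines (λ x N _ → Expansion x N) public
  open SpineSubstitution exp-sub exp-var public

  Args→Pointwise : ∀ {b} {αs : List (Fin b)} {As f} → Args αs As f → Pointwise Expansion αs As
  Args→Pointwise []      = []
  Args→Pointwise (d ∷ p) = d ∷ Args→Pointwise p

  Pointwise→Args : ∀ {b} {αs : List (Fin b)} {As} → Pointwise Expansion αs As → Args αs As false
  Pointwise→Args []      = []
  Pointwise→Args (d ∷ p) = d ∷ Pointwise→Args p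

  spine-lams : ∀ m {b} {x : Fin b} {X : Tm (m + b)} {f} → Spine (m ↑ʳ x) (binders m) X f → Spine x [] (lams m X) f
  spine-lams zero    s = s
  spine-lams (suc m) s = spine-lams m (spine-lam ε s)

  layer→spine : ∀ {b} {x : Fin b} {N} → Layer Expansion x [] N → Spine x [] N false
  layer→spine (m , As , r , p) = spine-←h* r (spine-lams m (spine-app ε (Pointwise→Args p)))

  spine→layer : ∀ {b} {x : Fin b} {αs N f} → Spine x αs N f → Layer Expansion x αs N
  spine→layer {αs = αs} (spine-app {As = As} r p) =
    0 , As , r , subst (λ l → Pointwise Expansion l As) (sym (trans (++-identityʳ _) (map-id αs))) (Args→Pointwise p)
  spine→layer {b} {x = x} {αs} (spine-lam r s) with spine→layer s
  ... | m , As , r₁ , p = suc m , map (ren sh) As , r ◅◅ subst (_ →h*_) shifted (lam-→h* r₁) ,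
                          subst (λ l → Pointwise Expansion l (map (ren sh) As)) (shiftIn-layer m αs) (Pointwise-ren sh p)
    where
    sh = shiftIn m b
    shifted : lam (lams m (apps (var (m ↑ʳ suc x)) As)) ≡ lams (suc m) (apps (var (suc m ↑ʳ x)) (map (ren sh) As))
    shifted = trans (lam-lams m _) (cong (lams (suc m)) (trans (ren-apps sh (var (m ↑ʳ suc x)) As)
                (cong (λ h → apps (var h) (map (ren sh) As)) (shiftIn-↑ʳ m x))))

  -- every expansion unfolds to a spine; the case exp-sub is the substitution lemma
  unfold : ∀ {b} {x : Fin b} {N} → Expansion x N → Spine x [] N false
  unfold (exp-base p)      = layer→spine (Layer-map {S = RelVar R} exp-base (rootLayer→layer {S = RelVar R} (unfold-root {R = R} (R-post p))))
  unfold exp-var           = spine-app ε []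
  unfold (exp-sub d₁ d₂)   = spine-sub (unfold d₁) _ (unfold d₂) []
  unfold (exp-←h* r d)     = spine-←h* r (unfold d)
  unfold (exp-layer l)     = layer→spine l

  expansion-layer : ∀ {b} {x : Fin b} {N} → Expansion x N → Layer Expansion x [] N
  expansion-layer d = spine→layer (unfold d)

  spine→expansion : ∀ {b} {x : Fin b} {N f} → Spine x [] N f → Expansion x N
  spine→expansion s = exp-layer (spine→layer s)

  -- Together with variables related to their expansions
  -- these form a post-fixed point, so expansions of the identity are in ETA_ω.

  IdExpansion : ∀ {b} → Tm b → Set
  IdExpansion Q = Σ _ λ N → (Q →h* lam N) × Expansion zero N

  rootLayer→IdExpansion : ∀ {b} {Q : Tm b} → RootLayer Expansion id 1 zero Q → IdExpansion Q
  rootLayer→IdExpansion {b} (m , As , r , p) =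
    lams m (ren so X) , subst (_ →h*_) (lams-lam m X) r ,
    exp-layer (m , map (ren so) As , subst (lams m (ren so X) →h*_) body ε ,
               subst (λ l → Pointwise Expansion l (map (ren so) As)) args (Pointwise-ren so p))
    where
    so = shiftOut m b
    h  = cast (eqη m 1 b) (m ↑ʳ zero)
    X  = apps (var h) As
    so-h : ∀ i → so (cast (eqη m 1 b) i) ≡ i
    so-h = cast-involutive (sym (+-suc m b)) (eqη m 1 b)
    body : lams m (ren so X) ≡ lams m (apps (var (m ↑ʳ zero)) (map (ren so) As))
    body = cong (lams m) (trans (ren-apps so (var h) As) (cong (λ y → apps (var y) (map (ren so) As)) (so-h (m ↑ʳ zero))))
    args : map so (map (zvar 1 m) (allFin m)) ≡ binders m
    args = trans (cong (map so) (zvar-binders 1 m))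
                 (trans (sym (map-∘ (binders m))) (trans (map-cong so-h (binders m)) (map-id (binders m))))

  IdExpansion→rootLayer : ∀ {a b} {ρ : Fin a → Fin b} {N} → IdExpansion N → RootLayer Expansion ρ 1 zero N
  IdExpansion→rootLayer {b = b} (N₁ , r , d) with expansion-layer d
  ... | m , As , r₁ , p =
    m , map (ren si) As , subst (_ →h*_) body (r ◅◅ lam-→h* r₁) ,
    subst (λ l → Pointwise Expansion l (map (ren si) As)) (sym (zvar-binders 1 m)) (Pointwise-ren si p)
    where
    si = shiftIn m b
    body : lam (lams m (apps (var (m ↑ʳ zero)) As)) ≡ lams (suc m) (apps (var (si (m ↑ʳ zero))) (map (ren si) As))
    body = trans (lam-lams m _) (cong (lams (suc m)) (ren-apps si (var (m ↑ʳ zero)) As))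

  Expanded : Rel
  Expanded ρ M N = (Σ _ λ x → (M ≡ var x) × Expansion (ρ x) N) ⊎ ((M ≡ 𝙸) × IdExpansion N)

  expanded-var : ∀ {b} {x : Fin b} {N} → Expansion x N → RelVar Expanded x N
  expanded-var d = inj₁ (_ , refl , d)

  Expanded-postFixed : PostFixed Expanded
  Expanded-postFixed {ρ = ρ} (inj₁ (x , refl , d)) =
    fold-root {R = Expanded} {ρ = ρ} {k = 0} {y = x} (layer→rootLayer {S = RelVar Expanded} {ρ = ρ} {x = x} (Layer-map {S = Expansion} expanded-var (expansion-layer d)))
  Expanded-postFixed {ρ = ρ} (inj₂ (refl , e)) =
    fold-root {R = Expanded} {ρ = ρ} {k = 1} {y = zero} (RootLayer-map {S = Expansion} expanded-var {ρ = ρ} {k = 1} {y = zero} (IdExpansion→rootLayer {ρ = ρ} e))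

  IdExpansion→ETAω : ∀ {b} {Q : Tm b} → IdExpansion Q → ETAω Q
  IdExpansion→ETAω e = Expanded , Expanded-postFixed , inj₂ (refl , e)

  R→IdExpansion : ∀ {b} {Q : Tm b} → R id 𝙸 Q → IdExpansion Q
  R→IdExpansion p = rootLayer→IdExpansion (RootLayer-map {S = RelVar R} exp-base {ρ = id} {k = 1} {y = zero} (unfold-root {R = R} (R-post p)))

  applied-expansion : ∀ {b} {Q : Tm b} → IdExpansion Q → Expansion zero (app (ren suc Q) (var zero))
  applied-expansion (N , r , d) = exp-←h* (weaken-app-→h* r (var zero)) (exp-sub {σ = sub1 (var zero) ∘ ext suc} d exp-var)

  -- Q₁ ∘ Q₂ ↠ λx.Q₁(Q₂ x), and Q₁(Q₂ x) expands x: substitute Q₂ x in the expansion Q₁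
  IdExpansion-∘ : ∀ {b} {Q₁ Q₂ : Tm b} → IdExpansion Q₁ → IdExpansion Q₂ → IdExpansion (Q₁ ∘ₜ Q₂)
  IdExpansion-∘ {Q₁ = Q₁} {Q₂} (N₁ , r₁ , d₁) e₂ =
    _ , ∘-→h* Q₁ Q₂ , exp-←h* (weaken-app-→h* r₁ W) (exp-sub {σ = sub1 W ∘ ext suc} d₁ (applied-expansion e₂))
    where W = app (ren suc Q₂) (var zero)

  spine-sub-𝙸 : ∀ {a b} {y : Fin a} {α αs P f} → Spine y (α ∷ αs) P f → (σ : Fin a → Tm b) → σ y ≡ 𝙸 →
    ∀ {β βs c} → Expansion β (σ α) → SubArgs σ αs βs c → Σ Bool λ g → Spine β βs (sub σ P) g
  spine-sub-𝙸 (spine-app {As = A₁ ∷ As} r (d ∷ p)) σ e dβ q =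
    _ , spine-←h* (sub-𝙸-head {A₁ = A₁} {As} σ e r) (spine-apps (unfold (exp-sub {σ = σ} d dβ)) (Args-sub p q))
  spine-sub-𝙸 (spine-lam r s) σ e dβ q
    with spine-sub-𝙸 s (exts σ) (cong (ren suc) e) (Expansion-ren suc dβ) (SubArgs-exts q)
  ... | g , s' = g , spine-lam (sub-→h* σ r) s'

  -- Q 𝙸 ↠ N[𝙸] for Q ↠ λx.N; if N ↠ x the result is 𝙸, otherwise N ↠ λy.N'
  -- with N' a spine of x y, and 𝙸 for x leaves an expansion of y
  IdExpansion-app𝙸 : ∀ {b} {Q : Tm b} → IdExpansion Q → IdExpansion (app Q 𝙸)
  IdExpansion-app𝙸 (N , r , d) with unfold d
  ... | spine-app r' [] = var zero , app-→h*-β 𝙸 r ◅◅ sub-→h* (sub1 𝙸) r' , exp-var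
  ... | spine-lam r' s with spine-sub-𝙸 s (exts (sub1 𝙸)) refl exp-var []
  ... | _ , s' = _ , app-→h*-β 𝙸 r ◅◅ sub-→h* (sub1 𝙸) r' , spine→expansion s'

-- Deep h N says that BT(N) has a branch through h
-- application nodes.  A finite Böhm tree has bounded depth; an infinite one
-- (¬ FiniteBT) is, up to double negation, deeper than every bound.

data Deep : ∀ {b} → ℕ → Tm b → Set where
  deep-0   : ∀ {b} {N : Tm b} → Deep 0 N
  deep-lam : ∀ {b h} {N : Tm b} {N₁} → N →h* lam N₁ → Deep h N₁ → Deep h N
  deep-app : ∀ {b h} {N : Tm b} {y As} → N →h* apps (var y) As → Any (Deep h) As → Deep (suc h) N

Deep-←h* : ∀ {b h} {M N : Tm b} → M →h* N → Deep h N → Deep h M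
Deep-←h* r deep-0          = deep-0
Deep-←h* r (deep-lam r' d) = deep-lam (r ◅◅ r') d
Deep-←h* r (deep-app r' a) = deep-app (r ◅◅ r') a

-- by determinism of head reduction, depth is also preserved forwards
Deep-→h* : ∀ {b h} {M N : Tm b} → M →h* N → Deep h M → Deep h N
Deep-→h* r deep-0 = deep-0
Deep-→h* r (deep-lam r' d) with det* r' r
... | inj₂ later = deep-lam later d
... | inj₁ earlier with lam-→h*-inv earlier
... | _ , refl , r₁ = deep-lam ε (Deep-→h* r₁ d)
Deep-→h* r (deep-app {y = y} {As} r' a) = deep-app (det-normal r' r (hnf-normal 0 y As)) a

Deep-body : ∀ {b h} {N : Tm b} {N₁} → N →h* lam N₁ → Deep h N → Deep h N₁
Deep-body r d with Deep-→h* r d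
... | deep-0          = deep-0
... | deep-lam r' d'  = Deep-←h* (lam-→h*-body r') d'
... | deep-app {y = y} {As} r' a = ⊥-elim (lam-↛NotLam r' (apps-var-NotLam y As))

Deep-pred : ∀ {b h} {N : Tm b} → Deep (suc h) N → Deep h N
Deep-pred (deep-lam r d)             = deep-lam r (Deep-pred d)
Deep-pred {h = zero}  (deep-app r a) = deep-0
Deep-pred {h = suc h} (deep-app r a) = deep-app r (Any.map Deep-pred a)

Deep-≤′ : ∀ {b h H} {N : Tm b} → h ≤′ H → Deep H N → Deep h N
Deep-≤′ ≤′-refl      d = d
Deep-≤′ (≤′-step le) d = Deep-≤′ le (Deep-pred d)

Deep-ren : ∀ {a b h} (ρ : Fin a → Fin b) {N} → Deep h N → Deep h (ren ρ N)
Deep-ren ρ deep-0         = deep-0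
Deep-ren ρ (deep-lam r d) = deep-lam (ren-→h* ρ r) (Deep-ren (ext ρ) d)
Deep-ren ρ (deep-app {y = y} {As} r a) =
  deep-app (subst (_ →h*_) (ren-apps ρ (var y) As) (ren-→h* ρ r)) (Any-map⁺ (Any.map (Deep-ren ρ) a))

hnf-deep : ∀ {b h} k {N : Tm b} {y : Fin (k + b)} {Ms} → N →h* hnf k y Ms → Any (Deep h) Ms → Deep (suc h) N
hnf-deep zero        r a = deep-app r a
hnf-deep {b} (suc k) {y = y} {Ms} r a =
  deep-lam (subst (_ →h*_) (trans (lams-lam k _) (cong (λ T → lam (lams k T)) (ren-apps (shiftOut k b) (var y) Ms))) r)
           (hnf-deep k ε (Any-map⁺ (Any.map (Deep-ren (shiftOut k b)) a)))

Deep→HasHnf : ∀ {b h} {N : Tm b} → Deep (suc h) N → HasHnf N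
Deep→HasHnf (deep-app {y = y} {As} r a) = 0 , y , As , r
Deep→HasHnf {b} (deep-lam r d) with Deep→HasHnf d
... | k , y , Ms , r₁ = suc k , shiftIn k b y , map (ren (shiftIn k b)) Ms ,
  subst (_ →h*_) (trans (lam-lams k _) (cong (lams (suc k)) (ren-apps (shiftIn k b) (var y) Ms))) (r ◅◅ lam-→h* r₁)

hnf-shallow : ∀ {b H} k {N : Tm b} {y : Fin (k + b)} {Ms} → N →h* hnf k y Ms → All (λ M → ¬ Deep H M) Ms →
  ¬ Deep (suc H) N
hnf-shallow k {y = y} {Ms} r ns (deep-lam r' d) with det-normal r r' (hnf-normal k y Ms)
hnf-shallow zero {y = y} {Ms} r ns (deep-lam r' d) | back = lam-↛NotLam back (apps-var-NotLam y Ms)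
hnf-shallow {b} (suc k) {y = y} {Ms} r ns (deep-lam r' d) | back =
  hnf-shallow k (subst (_ →h*_) (cong (lams k) (ren-apps (shiftOut k b) (var y) Ms))
                  (lam-→h*-body (subst (lam _ →h*_) (lams-lam k _) back)))
              (All-map⁺ (All.map (λ n d → n (shallow-back d)) ns)) d
  where
  shallow-back : ∀ {H M} → Deep H (ren (shiftOut k b) M) → Deep H M
  shallow-back {M = M} d = subst (Deep _) (ren-inverse (shiftIn-shiftOut k b) M) (Deep-ren (shiftIn k b) d)
hnf-shallow k {y = y} {Ms} r ns (deep-app {y = y'} {As} r' a)
  with det-normal₂ r r' (hnf-normal k y Ms) (hnf-normal 0 y' As)
... | e with hnf-lams-injective k 0 y y' Ms As e
... | refl with hnf-injective 0 y y' Ms As e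
... | refl , refl = All¬⇒¬Any ns a

mutual
  finite-shallow : ∀ {b} {N : Tm b} → FiniteBT N → Σ ℕ λ H → ¬ Deep H N
  finite-shallow (fin-bot no-hnf) = 1 , λ d → no-hnf (Deep→HasHnf d)
  finite-shallow (fin-node {k = k} r fs) with finites-shallow fs
  ... | H , ns = suc H , hnf-shallow k r ns

  finites-shallow : ∀ {b} {Ms : List (Tm b)} → All FiniteBT Ms → Σ ℕ λ H → All (λ M → ¬ Deep H M) Ms
  finites-shallow []       = 0 , []
  finites-shallow (f ∷ fs) with finite-shallow f | finites-shallow fs
  ... | H₁ , n₁ | H₂ , ns = H₁ + H₂ , (n₁ ∘ Deep-≤′ (≤⇒≤′ (m≤m+n H₁ H₂)))
                                    ∷ All.map (_∘ Deep-≤′ (≤⇒≤′ (m≤n+m H₂ H₁))) ns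

All-¬¬ : ∀ {A : Set} {P : A → Set} {xs} → All (λ x → ¬ ¬ P x) xs → ¬ ¬ All P xs
All-¬¬ []       k = k []
All-¬¬ (p ∷ ps) k = p (λ q → All-¬¬ ps (λ qs → k (q ∷ qs)))

infinite-deep : ∀ {b} h {N : Tm b} → ¬ FiniteBT N → ¬ ¬ Deep h N
infinite-deep zero    inf shallow = shallow deep-0
infinite-deep (suc h) inf shallow = inf (fin-bot no-hnf)
  where
  no-hnf : ¬ HasHnf _
  no-hnf (k , y , Ms , r) =
    All-¬¬ (All.map (λ shallowM infM → infinite-deep h infM shallowM) (¬Any⇒All¬ Ms (shallow ∘ hnf-deep k r)))
           (inf ∘ fin-node r)

infinite-transfer : ∀ {a b} {M : Tm a} {N : Tm b} → (∀ h → Deep (suc h) M → Deep h N) → ¬ FiniteBT M → ¬ FiniteBT N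
infinite-transfer t inf fin with finite-shallow fin
... | H , shallow = infinite-deep (suc H) inf (shallow ∘ t H)

-- The proof
-- reruns the spine substitution lemma with arguments traced by depth: a flag
-- true on an argument certifies that it is deep, so a spine flagged true is one
-- level deeper.
module DeepExpansions (R : Rel) (R-post : PostFixed R) where
  open Expansions R R-post

  TracedExp : ℕ → ∀ {b} → Fin b → Tm b → Bool → Set
  TracedExp h x N f = Expansion x N × (T f → Deep h N)

  traced-var : ∀ {h b} {x : Fin b} → TracedExp h x (var x) false
  traced-var = exp-var , λ ()

  module TS (h : ℕ) = Spines (TracedExp h)

  untracedArgs : ∀ h {b} {αs : List (Fin b)} {As f} → Args αs As f → TS.Args h αs As false
  untracedArgs h []      = TS.[]
  untracedArgs h (d ∷ p) = (d , λ ()) TS.∷ untracedArgs h p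

  untraced : ∀ h {b} {x : Fin b} {αs N f} → Spine x αs N f → TS.Spine h x αs N false
  untraced h (spine-app r p) = TS.spine-app r (untracedArgs h p)
  untraced h (spine-lam r s) = TS.spine-lam r (untraced h s)

  tracedArgs : ∀ h {b} {αs : List (Fin b)} {As f} → Args αs As f → Any (Deep h) As → TS.Args h αs As true
  tracedArgs h (d ∷ p) (here deep) = (d , λ _ → deep) TS.∷ untracedArgs h p
  tracedArgs h (d ∷ p) (there a)   = TS._∷_ {f = false} (d , λ ()) (tracedArgs h p a)

  -- a spine of a term of depth h+1 has a deep argument, which we flag
  traced : ∀ h {b} {x : Fin b} {αs N f} → Spine x αs N f → Deep (suc h) N → TS.Spine h x αs N true
  traced h (spine-app {x = x} {As = As} r p) deep with Deep-→h* r deep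
  ... | deep-lam r' _ = ⊥-elim (lam-↛NotLam ε (subst NotLam (normal-end r' (hnf-normal 0 x As)) (apps-var-NotLam x As)))
  ... | deep-app {As = As'} r' a with apps-var-injective As As' (normal-end r' (hnf-normal 0 x As))
  ... | refl , refl = TS.spine-app r (tracedArgs h p a)
  traced h (spine-lam r s) deep = TS.spine-lam r (traced h s (Deep-body r deep))

  flagged-deep : ∀ h {b} {αs : List (Fin b)} {As f} → TS.Args h αs As f → T f → Any (Deep h) As
  flagged-deep h (TS._∷_ {f = true}  (_ , deep) p) t = here (deep tt)
  flagged-deep h (TS._∷_ {f = false} _          p) t = there (flagged-deep h p t)

  traced-deep : ∀ h {b} {x : Fin b} {αs N f} → TS.Spine h x αs N f → T f → Deep (suc h) N
  traced-deep h (TS.spine-app r p) t = deep-app r (flagged-deep h p t)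
  traced-deep h (TS.spine-lam r s) t = deep-lam r (traced-deep h s t)

  mutual
    TracedExp-sub : ∀ h {a b} {α : Fin a} {A : Tm a} {σ : Fin a → Tm b} {β : Fin b} {f g} →
      TracedExp h α A f → TracedExp h β (σ α) g → TracedExp h β (sub σ A) (f ∨ g)
    TracedExp-sub h {f = true}  (d₁ , deep₁) (d₂ , _)     = exp-sub d₁ d₂ , λ _ → sub-deep h d₁ d₂ (deep₁ tt)
    TracedExp-sub h {f = false} (d₁ , _)     (d₂ , deep₂) = exp-sub d₁ d₂ , λ t → sub-deep-head h d₁ d₂ (deep₂ t)

    sub-deep : ∀ h {a b} {y : Fin a} {P : Tm a} {σ : Fin a → Tm b} {x : Fin b} →
      Expansion y P → Expansion x (σ y) → Deep h P → Deep h (sub σ P)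
    sub-deep zero    d₁ d₂ deep = deep-0
    sub-deep (suc h) {σ = σ} d₁ d₂ deep = traced-deep h
      (Spines.SpineSubstitution.spine-sub (TracedExp h) (TracedExp-sub h) traced-var
        (traced h (unfold d₁) deep) σ (untraced h (unfold d₂)) TS.[]) tt

    sub-deep-head : ∀ h {a b} {y : Fin a} {P : Tm a} {σ : Fin a → Tm b} {x : Fin b} →
      Expansion y P → Expansion x (σ y) → Deep h (σ y) → Deep h (sub σ P)
    sub-deep-head zero    d₁ d₂ deep = deep-0
    sub-deep-head (suc h) {σ = σ} d₁ d₂ deep = traced-deep h
      (Spines.SpineSubstitution.spine-sub (TracedExp h) (TracedExp-sub h) traced-var
        (untraced h (unfold d₁)) σ (traced h (unfold d₂) deep) TS.[]) tt

  module TSS (h : ℕ) = Spines.SpineSubstitution (TracedExp h) (TracedExp-sub h) traced-var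

  Args-pred : ∀ h {b} {αs : List (Fin b)} {As f} → TS.Args (suc h) αs As f → TS.Args h αs As f
  Args-pred h TS.[]               = TS.[]
  Args-pred h ((d , deep) TS.∷ p) = (d , Deep-pred ∘ deep) TS.∷ Args-pred h p

  spine-sub-𝙸-deep : ∀ h {a b} {y : Fin a} {α αs P f} → TS.Spine (suc h) y (α ∷ αs) P f → T f →
    (σ : Fin a → Tm b) → σ y ≡ 𝙸 → ∀ {β βs} → Expansion β (σ α) → TS.SubArgs h σ αs βs false → Deep (suc h) (sub σ P)
  spine-sub-𝙸-deep h (TS.spine-app {As = A₁ ∷ As} r (TS._∷_ {f = true} (d₁ , deep₁) p)) t σ e dβ q =
    Deep-←h* (sub-𝙸-head {A₁ = A₁} {As} σ e r) (traced-deep h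
      (TSS.spine-apps h (traced h (unfold (exp-sub {σ = σ} d₁ dβ)) (sub-deep (suc h) d₁ dβ (deep₁ tt)))
                        (TSS.Args-sub h (Args-pred h p) q)) tt)
  spine-sub-𝙸-deep h (TS.spine-app {As = A₁ ∷ As} r (TS._∷_ {f = false} {g = g} (d₁ , _) p)) t σ e dβ q =
    Deep-←h* (sub-𝙸-head {A₁ = A₁} {As} σ e r) (traced-deep h
      (TSS.spine-apps h (untraced h (unfold (exp-sub {σ = σ} d₁ dβ))) (TSS.Args-sub h (Args-pred h p) q))
      (subst T (sym (∨-identityʳ g)) t))
  spine-sub-𝙸-deep h (TS.spine-lam r s) t σ e dβ q = deep-lam (sub-→h* σ r)
    (spine-sub-𝙸-deep h s t (exts σ) (cong (ren suc) e) (Expansion-ren suc dβ) (TSS.SubArgs-exts h q))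

  app𝙸-deep : ∀ {b h} {Q : Tm b} → IdExpansion Q → Deep (suc (suc h)) Q → Deep (suc h) (app Q 𝙸)
  app𝙸-deep {h = h} (N , r , d) deep with unfold d
  ... | spine-app r' [] = ⊥-elim (hnf-shallow 0 r' [] (Deep-body r deep))
  ... | spine-lam r' s  = Deep-←h* (app-→h*-β 𝙸 r ◅◅ sub-→h* (sub1 𝙸) r') (deep-lam ε
          (spine-sub-𝙸-deep h (traced (suc h) s (Deep-body r' (Deep-body r deep))) tt (exts (sub1 𝙸)) refl exp-var TS.[]))

  applied-deep : ∀ {b h} {Q : Tm b} → IdExpansion Q → Deep h Q → Deep h (app (ren suc Q) (var zero))
  applied-deep {h = h} (N , r , d) deep =
    Deep-←h* (weaken-app-→h* r (var zero)) (sub-deep h {σ = sub1 (var zero) ∘ ext suc} d exp-var (Deep-body r deep))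

  ∘-deep : ∀ {b h} {Q₁ Q₂ : Tm b} → IdExpansion Q₁ → IdExpansion Q₂ → Deep h Q₁ ⊎ Deep h Q₂ → Deep h (Q₁ ∘ₜ Q₂)
  ∘-deep {h = h} {Q₁} {Q₂} (N₁ , r₁ , d₁) e₂ deep =
    deep-lam (∘-→h* Q₁ Q₂) (Deep-←h* (weaken-app-→h* r₁ W) (body deep))
    where
    W = app (ren suc Q₂) (var zero)
    body : Deep h Q₁ ⊎ Deep h Q₂ → Deep h (sub (sub1 W ∘ ext suc) N₁)
    body (inj₁ deep₁) = sub-deep h d₁ (applied-expansion e₂) (Deep-body r₁ deep₁)
    body (inj₂ deep₂) = sub-deep-head h {P = N₁} d₁ (applied-expansion e₂) (applied-deep e₂ deep₂)

  IdExpansion-∘-infinite : ∀ {b} {Q₁ Q₂ : Tm b} → IdExpansion Q₁ → IdExpansion Q₂ →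
    (¬ FiniteBT Q₁) ⊎ (¬ FiniteBT Q₂) → ¬ FiniteBT (Q₁ ∘ₜ Q₂)
  IdExpansion-∘-infinite e₁ e₂ (inj₁ inf) = infinite-transfer (λ h → Deep-pred ∘ ∘-deep e₁ e₂ ∘ inj₁) inf
  IdExpansion-∘-infinite e₁ e₂ (inj₂ inf) = infinite-transfer (λ h → Deep-pred ∘ ∘-deep e₁ e₂ ∘ inj₂) inf

  IdExpansion-app𝙸-infinite : ∀ {b} {Q : Tm b} → IdExpansion Q → ¬ FiniteBT Q → ¬ FiniteBT (app Q 𝙸)
  IdExpansion-app𝙸-infinite e = infinite-transfer λ { zero _ → deep-0 ; (suc h) → app𝙸-deep e }

-- Two hypotheses Q₁, Q₂ ∈ ETA_ω come with two post-fixed points; their union is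
-- again one, since Step is monotone.

_∪_ : Rel → Rel → Rel
(R₁ ∪ R₂) ρ M N = R₁ ρ M N ⊎ R₂ ρ M N

Step-mono : ∀ {R R' : Rel} → (∀ {a b} {ρ : Fin a → Fin b} {M N} → R ρ M N → R' ρ M N) →
  ∀ {a b} {ρ : Fin a → Fin b} {M N} → Step R ρ M N → Step R' ρ M N
Step-mono f (inj₁ no-hnfs) = inj₁ no-hnfs
Step-mono f (inj₂ (k , m , y , Ms , Ns , N's , r₁ , r₂ , p₁ , p₂)) =
  inj₂ (k , m , y , Ms , Ns , N's , r₁ , r₂ , Pointwise.map f p₁ , Pointwise.map f p₂)

∪-postFixed : ∀ {R₁ R₂ : Rel} → PostFixed R₁ → PostFixed R₂ → PostFixed (R₁ ∪ R₂)
∪-postFixed {R₁} {R₂} post₁ post₂ (inj₁ p) = Step-mono {R = R₁} {R' = R₁ ∪ R₂} inj₁ (post₁ p)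
∪-postFixed {R₁} {R₂} post₁ post₂ (inj₂ p) = Step-mono {R = R₂} {R' = R₁ ∪ R₂} inj₂ (post₂ p)

ETAω-∘ : ∀ {n} (Q₁ Q₂ : Tm n) → ETAω Q₁ → ETAω Q₂ → ETAω (Q₁ ∘ₜ Q₂)
ETAω-∘ Q₁ Q₂ (R₁ , post₁ , p₁) (R₂ , post₂ , p₂) =
  IdExpansion→ETAω (IdExpansion-∘ (R→IdExpansion (inj₁ p₁)) (R→IdExpansion (inj₂ p₂)))
  where open Expansions (R₁ ∪ R₂) (∪-postFixed post₁ post₂)

ETA∞-∘ : ∀ {n} (Q₁ Q₂ : Tm n) → ETAω Q₁ → ETAω Q₂ → ETA∞ Q₁ ⊎ ETA∞ Q₂ → ETA∞ (Q₁ ∘ₜ Q₂)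
ETA∞-∘ Q₁ Q₂ η₁@(R₁ , post₁ , p₁) η₂@(R₂ , post₂ , p₂) inf =
  ETAω-∘ Q₁ Q₂ η₁ η₂ ,
  IdExpansion-∘-infinite (R→IdExpansion (inj₁ p₁)) (R→IdExpansion (inj₂ p₂)) (⊎-map proj₂ proj₂ inf)
  where
  open Expansions (R₁ ∪ R₂) (∪-postFixed post₁ post₂)
  open DeepExpansions (R₁ ∪ R₂) (∪-postFixed post₁ post₂)

ETA∞-app𝙸 : ∀ {n} (Q : Tm n) → ETA∞ Q → ETA∞ (app Q 𝙸)
ETA∞-app𝙸 Q ((R , post , p) , inf) =
  IdExpansion→ETAω (IdExpansion-app𝙸 (R→IdExpansion p)) , IdExpansion-app𝙸-infinite (R→IdExpansion p) inf
  where
  open Expansions R post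
  open DeepExpansions R post

lemma4p6 : ∀ {n : ℕ} →
    ((Q₁ Q₂ : Tm n) → ETAω Q₁ → ETAω Q₂ → ETAω (Q₁ ∘ₜ Q₂))
    × ((Q₁ Q₂ : Tm n) → ETAω Q₁ → ETAω Q₂ → ETA∞ Q₁ ⊎ ETA∞ Q₂ → ETA∞ (Q₁ ∘ₜ Q₂))
    × ((Q : Tm n) → ETA∞ Q → ETA∞ (app Q 𝙸))
lemma4p6 = ETAω-∘ , ETA∞-∘ , ETA∞-app𝙸
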